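{- Let $n\ge1$ and let $(W,\preccurlyeq,S)$ be an $\mathrm{ITL}^{\mathrm{bd}}_n$ frame. For every $w\in W$, if $w$ is maximal with respect to $\preccurlyeq$, then $S(w)$ is maximal with respect to $\preccurlyeq$.
   Context: An intuitionistic temporal frame is $(W,\preccurlyeq,S)$ with $W\ne\emptyset$, $\preccurlyeq$ a partial order, and $S:W\to W$ a function satisfying forward confluence ($w\preccurlyeq v\Rightarrow S(w)\preccurlyeq S(v)$). It is persistent if it also satisfies backward confluence: whenever $S(w)=v$ and $v\preccurlyeq u$, there is $t$ with $w\preccurlyeq t$ and $S(t)=u$. An $\mathrm{ITL}^{\mathrm{bd}}_n$ frame is a persistent intuitionistic temporal frame in which $\preccurlyeq$ has depth at most $n$, i.e., there is no chain of more than $n$ distinct worlds. A world $w$ is maximal if there is no $v\ne w$ with $w\preccurlyeq v$. -}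

module Defs where

open import Level using (Level; suc; _⊔_)
open import Data.Nat using (ℕ)
open import Data.Fin using (Fin)
open import Data.Product using (Σ; ∃; _×_)
open import Data.Sum using (_⊎_)
open import Data.Empty using (⊥)
open import Relation.Binary.PropositionalEquality using (_≡_; _≢_)
open import Relation.Nullary using (¬_)
open import Relation.Binary.Structures using (IsPartialOrder)
open import Function.Definitions using (Injective)

record ITFrame (a ℓ : Level) : Set (suc (a ⊔ ℓ)) where
  field
    W          : Set a
    inhabitant : W
    _≼_        : W → W → Set ℓ
    isPO       : IsPartialOrder _≡_ _≼_
    S          : W → W
    forwardConfluence : ∀ {w v} → w ≼ v → S w ≼ S v

  BackwardConfluent : Set (a ⊔ ℓ)
  BackwardConfluent = ∀ w v u → S w ≡ v → v ≼ u → Σ W λ t → (w ≼ t) × (S t ≡ u)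

  IsChain : {k : ℕ} → (Fin k → W) → Set (a ⊔ ℓ)
  IsChain {k} f = Injective _≡_ _≡_ f × (∀ i j → (f i ≼ f j) ⊎ (f j ≼ f i))

  DepthAtMost : ℕ → Set (a ⊔ ℓ)
  DepthAtMost n = ∀ (k : ℕ) → n Data.Nat.< k → (f : Fin k → W) → IsChain f → ⊥

  Maximal : W → Set (a ⊔ ℓ)
  Maximal w = ¬ (Σ W λ v → (v ≢ w) × (w ≼ v))

record ITLbdFrame (n : ℕ) (a ℓ : Level) : Set (suc (a ⊔ ℓ)) where
  field
    frame      : ITFrame a ℓ
  open ITFrame frame public
  field
    persistent : BackwardConfluent
    depth      : DepthAtMost n

{-# OPTIONS --safe #-}
module Submission where

open import Defs
open import Level using (Level)
open import Data.Nat using (ℕ; _≥_)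
open import Data.Product using (_,_)
open import Relation.Binary.PropositionalEquality using (refl; sym; trans; cong)

module _ {a ℓ : Level} (F : ITFrame a ℓ) where
  open ITFrame F

  maximal⇒S-maximal : BackwardConfluent → ∀ {w} → Maximal w → Maximal (S w)
  maximal⇒S-maximal backward {w} w-max (u , u≢Sw , Sw≼u) =
    let t , w≼t , St≡u = backward w (S w) u refl Sw≼u
        t≢w = λ t≡w → u≢Sw (trans (sym St≡u) (cong S t≡w))
    in w-max (t , t≢w , w≼t)

proposition7 : ∀ {a ℓ : Level} (n : ℕ) → n ≥ 1 → (F : ITLbdFrame n a ℓ) →
    ∀ (w : ITLbdFrame.W F) → ITLbdFrame.Maximal F w → ITLbdFrame.Maximal F (ITLbdFrame.S F w)
proposition7 _ _ F _ =
  maximal⇒S-maximal (ITLbdFrame.frame F) (ITLbdFrame.persistent F)
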